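{- Let $\mathcal{H}$ be a 3-uniform hypergraph containing no copy of $\mathcal{L}$ and let $\mathcal{H}'$ be its 22-core. Then for every vertex $v \in V(\mathcal{H}')$, the matching number $\nu(Tr_{\mathcal{H}'}(v))$ is neither 2 nor 3.
   Context: The loose path $\mathcal{L}$ is $\{abc, cde, efg\}$ on seven distinct vertices. The 22-core is obtained by iteratively deleting vertices of degree less than 22 (with their triples) until all remaining vertices have degree at least 22. For a vertex $v$, $Tr_{\mathcal{H}'}(v) = \{ e \setminus \{v\} : e \in \mathcal{H}', v \in e\}$ is the trace (link) graph of $v$, and $\nu$ denotes the maximum number of edges in a matching. -}

module Defs where

open import Data.Nat using (ℕ; zero; suc; _≤ᵇ_; _<ᵇ_)
open import Data.Fin using (Fin; toℕ)
open import Data.Bool using (Bool; true; false; _∧_)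
open import Data.List using (List; []; _∷_; length; filterᵇ; allFin; cartesianProduct; concatMap)
open import Data.List.Relation.Unary.All using (All)
open import Data.List.Relation.Unary.Unique.Propositional using (Unique)
open import Data.Product using (_×_; _,_; Σ; proj₁; proj₂)
open import Data.Vec using (Vec; lookup)
open import Relation.Binary.PropositionalEquality using (_≡_; _≢_)
open import Relation.Nullary using (¬_)
open import Function.Definitions using (Injective)

record Hypergraph3 (n : ℕ) : Set where
  field
    edge    : Fin n → Fin n → Fin n → Bool
    sym₁₂   : ∀ x y z → edge x y z ≡ edge y x z
    sym₂₃   : ∀ x y z → edge x y z ≡ edge x z y
    distinct : ∀ x y z → edge x y z ≡ true → (x ≢ y) × (y ≢ z) × (x ≢ z)
open Hypergraph3 public

-- H contains a copy of the loose path L = {abc, cde, efg} on seven distinct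
-- vertices a..g (not necessarily induced).
ContainsLoosePath : ∀ {n} → Hypergraph3 n → Set
ContainsLoosePath {n} H =
  Σ (Vec (Fin n) 7) λ f →
    Injective _≡_ _≡_ (lookup f) ×
    (edge H (lookup f (# 0)) (lookup f (# 1)) (lookup f (# 2)) ≡ true) ×
    (edge H (lookup f (# 2)) (lookup f (# 3)) (lookup f (# 4)) ≡ true) ×
    (edge H (lookup f (# 4)) (lookup f (# 5)) (lookup f (# 6)) ≡ true)
  where open import Data.Fin using (#_)

VSet : ℕ → Set
VSet n = Fin n → Bool

-- Unordered pairs {x,y}, represented once each by x < y.
orderedPairs : ∀ n → List (Fin n × Fin n)
orderedPairs n = filterᵇ (λ p → toℕ (proj₁ p) <ᵇ toℕ (proj₂ p))
                         (cartesianProduct (allFin n) (allFin n))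

-- Degree of v in the induced subhypergraph H[S]
-- (number of edges of H[S] containing v; assumes v ∈ S).
degIn : ∀ {n} → Hypergraph3 n → VSet n → Fin n → ℕ
degIn {n} H S v =
  length (filterᵇ (λ p → S (proj₁ p) ∧ S (proj₂ p) ∧ edge H v (proj₁ p) (proj₂ p))
                  (orderedPairs n))

deleteRound : ∀ {n} → ℕ → Hypergraph3 n → VSet n → VSet n
deleteRound k H S v = S v ∧ (k ≤ᵇ degIn H S v)

iter : ∀ {A : Set} → ℕ → (A → A) → A → A
iter zero    f a = a
iter (suc m) f a = iter m f (f a)

-- Vertex set of the k-core: iterate deletion rounds; on n vertices the
-- process stabilises after at most n rounds, so n rounds yield the core
-- (the result of iterative deletion is independent of deletion order).
coreVertices : ∀ {n} → ℕ → Hypergraph3 n → VSet n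
coreVertices {n} k H = iter n (deleteRound k H) (λ _ → true)

-- The k-core H' as a hypergraph is H induced on coreVertices k H.
-- Trace (link) graph of v in H[S]: edge {x,y} iff {v,x,y} is an edge of H[S].
traceEdge : ∀ {n} → Hypergraph3 n → VSet n → Fin n → Fin n → Fin n → Bool
traceEdge H S v x y = S v ∧ S x ∧ S y ∧ edge H v x y

pairVerts : ∀ {n} → List (Fin n × Fin n) → List (Fin n)
pairVerts = concatMap (λ p → proj₁ p ∷ proj₂ p ∷ [])

HasMatching : ∀ {n} → (Fin n → Fin n → Bool) → ℕ → Set
HasMatching {n} G m =
  Σ (List (Fin n × Fin n)) λ M →
    (length M ≡ m) ×
    All (λ p → G (proj₁ p) (proj₂ p) ≡ true) M ×
    Unique (pairVerts M)

MatchingNumberIs : ∀ {n} → (Fin n → Fin n → Bool) → ℕ → Set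
MatchingNumberIs G m = HasMatching G m × ¬ HasMatching G (suc m)

module Submission where

-- Let S be the vertex set of the 22-core of an L-free 3-graph H, so every vertex of S
-- lies in at least 22 edges of H[S] (the deletion rounds reach a fixed point).  Suppose
-- the link of v ∈ S has a maximum matching of size m ∈ {2, 3}, covering the set T,
-- |T| = 2m.  By maximality T meets every link edge of v.  If every link edge of v lies
-- inside T, then deg v ≤ C(2m,2).  Otherwise some link edge {r,t} has r ∉ T, t ∈ T.
-- With {a,b} the matching edge through t and {c,d} another one, the edges {v,a,b},
-- {v,c,d}, {v,r,t} force every edge through r that avoids v to stay inside T, for
-- otherwise H contains a loose path L; with maximality this gives deg r ≤ 2m + C(2m,2).
-- All these bounds are at most 21 < 22.

open import Defs
open import Data.Nat using (ℕ)
open import Data.Fin using (Fin)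
open import Data.Bool using (true)
open import Relation.Binary.PropositionalEquality using (_≡_)
open import Relation.Nullary using (¬_)
open import Data.Product using (_×_)

open import Data.Bool using (Bool; false; _∧_; if_then_else_) renaming (T to IsTrue)
open import Data.Bool.Properties using (T-≡) renaming (_≟_ to _≟ᵇ_)
open import Data.Empty using (⊥; ⊥-elim)
open import Data.Fin using (toℕ; #_; _≟_)
open import Data.Fin.Properties using (all?; ¬∀⟶∃¬)
open import Data.List using (List; []; _∷_; length; map; _++_; filterᵇ; allFin; cartesianProduct)
open import Data.List.Properties using (length-map; length-++; length-filter; filter-some; filter-≐; length-tabulate)
open import Data.List.Membership.Propositional using (_∈_; _∉_; find; lose)
open import Data.List.Membership.Propositional.Properties using (∈-filter⁻; ∈-map⁺; ∈-++⁺ˡ; ∈-++⁺ʳ; ∈-allFin)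
open import Data.List.Relation.Binary.Subset.Propositional using (_⊆_)
open import Data.List.Relation.Unary.All as All using (All; []; _∷_)
open import Data.List.Relation.Unary.All.Properties using (¬Any⇒All¬; ¬All⇒Any¬)
open import Data.List.Relation.Unary.AllPairs using ([]; _∷_)
open import Data.List.Relation.Unary.Any using (here; there)
open import Data.List.Relation.Unary.Unique.Propositional using (Unique)
open import Data.List.Relation.Unary.Unique.Propositional.Properties using (filter⁺; cartesianProduct⁺; allFin⁺)
open import Data.Nat using (zero; suc; _+_; _≤_; _<_; _<?_; z≤n; s≤s; _<ᵇ_; _≤ᵇ_)
open import Data.Nat.Properties using (<ᵇ⇒<; <⇒<ᵇ; <-irrefl; <-asym; ≤-trans; ≤-reflexive; ≤-<-trans; +-identityʳ; +-suc; +-monoˡ-≤; ≤ᵇ⇒≤; m≤n⇒m≤1+n; m≤n+m; module ≤-Reasoning)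
open import Data.Product using (_,_; proj₁; proj₂)
open import Data.Sum using (_⊎_; inj₁; inj₂; [_,_]′)
open import Data.Unit using (tt)
open import Data.Vec as Vec using (Vec; []; _∷_; lookup)
open import Data.Vec.Relation.Unary.All using ([]; _∷_)
open import Data.Vec.Relation.Unary.All.Properties using (fromList⁺)
open import Data.Vec.Relation.Unary.AllPairs using (allPairs?)
open import Data.Vec.Relation.Unary.Unique.Propositional using ([]; _∷_) renaming (Unique to Distinct)
open import Data.Vec.Relation.Unary.Unique.Propositional.Properties using (map⁺; lookup-injective)
open import Function using (_∘_; id; Equivalence)
open import Relation.Binary.PropositionalEquality using (_≢_; refl; sym; trans; cong; cong₂; subst; ≢-sym)
open import Relation.Nullary using (Dec; yes; no; ¬?)
open import Relation.Nullary.Decidable using (T?; True; toWitness; from-yes; _×-dec_)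

module _ {A : Set} where

  remove : ∀ {x} (ys : List A) → x ∈ ys → List A
  remove (_ ∷ ys) (here _)  = ys
  remove (y ∷ ys) (there p) = y ∷ remove ys p

  length-remove : ∀ {x} (ys : List A) (p : x ∈ ys) → suc (length (remove ys p)) ≡ length ys
  length-remove (_ ∷ ys) (here _)  = refl
  length-remove (y ∷ ys) (there p) = cong suc (length-remove ys p)

  ∈-remove : ∀ {x z} (ys : List A) (p : x ∈ ys) → z ∈ ys → z ≢ x → z ∈ remove ys p
  ∈-remove (_ ∷ ys) (here refl) (here refl) z≢x = ⊥-elim (z≢x refl)
  ∈-remove (_ ∷ ys) (here refl) (there z∈ys) _  = z∈ys
  ∈-remove (y ∷ ys) (there p)   (here refl) _   = here refl
  ∈-remove (y ∷ ys) (there p)   (there z∈ys) z≢x = there (∈-remove ys p z∈ys z≢x)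

  unique-⊆-length : ∀ {xs} (ys : List A) → Unique xs → xs ⊆ ys → length xs ≤ length ys
  unique-⊆-length {[]}     ys _            _   = z≤n
  unique-⊆-length {x ∷ xs} ys (x∉xs ∷ uxs) sub = begin
    suc (length xs)               ≤⟨ s≤s (unique-⊆-length (remove ys x∈ys) uxs sub′) ⟩
    suc (length (remove ys x∈ys)) ≡⟨ length-remove ys x∈ys ⟩
    length ys                     ∎
    where
    open ≤-Reasoning
    x∈ys : x ∈ ys
    x∈ys = sub (here refl)
    sub′ : xs ⊆ remove ys x∈ys
    sub′ z∈xs = ∈-remove ys x∈ys (sub (there z∈xs)) (λ z≡x → All.lookup x∉xs z∈xs (sym z≡x))

∧-true : ∀ {a b} → a ∧ b ≡ true → a ≡ true × b ≡ true
∧-true {true} b≡true = refl , b≡true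

module _ {n : ℕ} where

  -- The canonical representative (smaller index first) of the unordered pair {x, y},
  -- in the format used by orderedPairs and hence by degIn.
  pair : Fin n → Fin n → Fin n × Fin n
  pair x y = if toℕ x <ᵇ toℕ y then (x , y) else (y , x)

  pair-<ˡ : ∀ {x y} → toℕ x < toℕ y → pair x y ≡ (x , y)
  pair-<ˡ {x} {y} x<y with toℕ x <ᵇ toℕ y in eq
  ... | true  = refl
  ... | false = ⊥-elim (subst IsTrue eq (<⇒<ᵇ x<y))

  pair-<ʳ : ∀ {x y} → toℕ x < toℕ y → pair y x ≡ (x , y)
  pair-<ʳ {x} {y} x<y with toℕ y <ᵇ toℕ x in eq
  ... | true  = ⊥-elim (<-asym x<y (<ᵇ⇒< (toℕ y) (toℕ x) (subst IsTrue (sym eq) tt)))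
  ... | false = refl

  spokes : Fin n → List (Fin n) → List (Fin n × Fin n)
  spokes c = map (pair c)

  pairsOf : List (Fin n) → List (Fin n × Fin n)
  pairsOf []       = []
  pairsOf (x ∷ xs) = spokes x xs ++ pairsOf xs

  ∈-spokesˡ : ∀ {c q} xs → q ∈ xs → toℕ c < toℕ q → (c , q) ∈ spokes c xs
  ∈-spokesˡ {c} xs q∈xs c<q = subst (_∈ spokes c xs) (pair-<ˡ c<q) (∈-map⁺ (pair c) q∈xs)

  ∈-spokesʳ : ∀ {c p} xs → p ∈ xs → toℕ p < toℕ c → (p , c) ∈ spokes c xs
  ∈-spokesʳ {c} xs p∈xs p<c = subst (_∈ spokes c xs) (pair-<ʳ p<c) (∈-map⁺ (pair c) p∈xs)

  ∈-pairsOf : ∀ {p q} xs → p ∈ xs → q ∈ xs → toℕ p < toℕ q → (p , q) ∈ pairsOf xs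
  ∈-pairsOf (x ∷ xs) (here refl) (here refl) p<q = ⊥-elim (<-irrefl refl p<q)
  ∈-pairsOf (x ∷ xs) (here refl) (there q∈)  p<q = ∈-++⁺ˡ (∈-spokesˡ xs q∈ p<q)
  ∈-pairsOf (x ∷ xs) (there p∈)  (here refl) p<q = ∈-++⁺ˡ (∈-spokesʳ xs p∈ p<q)
  ∈-pairsOf (x ∷ xs) (there p∈)  (there q∈)  p<q = ∈-++⁺ʳ (spokes x xs) (∈-pairsOf xs p∈ q∈ p<q)

  length-spokes-pairsOf : ∀ c xs → length (spokes c xs ++ pairsOf xs) ≡ length xs + length (pairsOf xs)
  length-spokes-pairsOf c xs = trans (length-++ (spokes c xs)) (cong (_+ length (pairsOf xs)) (length-map (pair c) xs))

  orderedPairs-unique : Unique (orderedPairs n)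
  orderedPairs-unique = filter⁺ _ (cartesianProduct⁺ (allFin⁺ n) (allFin⁺ n))

  orderedPairs-< : ∀ {p q} → (p , q) ∈ orderedPairs n → toℕ p < toℕ q
  orderedPairs-< {p} {q} m =
    <ᵇ⇒< (toℕ p) (toℕ q) (proj₂ (∈-filter⁻ (T? ∘ λ z → toℕ (proj₁ z) <ᵇ toℕ (proj₂ z))
                                           {xs = cartesianProduct (allFin n) (allFin n)} m))

module Links {n : ℕ} (H : Hypergraph3 n) (S : VSet n) where

  inLink : Fin n → Fin n × Fin n → Bool
  inLink x z = S (proj₁ z) ∧ S (proj₂ z) ∧ edge H x (proj₁ z) (proj₂ z)

  link : Fin n → List (Fin n × Fin n)
  link x = filterᵇ (inLink x) (orderedPairs n)

  link-unique : ∀ x → Unique (link x)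
  link-unique x = filter⁺ (T? ∘ inLink x) orderedPairs-unique

  ∈-link : ∀ {x p q} → (p , q) ∈ link x →
           (S p ≡ true × S q ≡ true × edge H x p q ≡ true) × toℕ p < toℕ q
  ∈-link {x} m with ∈-filter⁻ (T? ∘ inLink x) m
  ... | m′ , inL with ∧-true (Equivalence.to T-≡ inL)
  ... | Sp , rest = (Sp , ∧-true rest) , orderedPairs-< m′

  degree-≤ : ∀ x (L : List (Fin n × Fin n)) → link x ⊆ L → degIn H S x ≤ length L
  degree-≤ x L = unique-⊆-length L (link-unique x)

filterᵇ-cong : ∀ {A : Set} {f g : A → Bool} → (∀ z → f z ≡ g z) → ∀ xs → filterᵇ f xs ≡ filterᵇ g xs
filterᵇ-cong {f = f} {g} f≗g =
  filter-≐ (T? ∘ f) (T? ∘ g) ((λ {z} → subst IsTrue (f≗g z)) , (λ {z} → subst IsTrue (sym (f≗g z))))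

iter-suc : ∀ {A : Set} k (g : A → A) a → iter (suc k) g a ≡ g (iter k g a)
iter-suc zero    g a = refl
iter-suc (suc k) g a = iter-suc k g (g a)

module _ {n : ℕ} where

  _⊆ᵥ_ : VSet n → VSet n → Set
  S ⊆ᵥ S′ = ∀ x → S x ≡ true → S′ x ≡ true

  _≐ᵥ_ : VSet n → VSet n → Set
  S ≐ᵥ S′ = ∀ x → S x ≡ S′ x

  size : VSet n → ℕ
  size S = length (filterᵇ S (allFin n))

  count-≤ : ∀ {S′ S} xs → S′ ⊆ᵥ S → length (filterᵇ S′ xs) ≤ length (filterᵇ S xs)
  count-≤ [] _ = z≤n
  count-≤ {S′} {S} (y ∷ xs) S′⊆S with S′ y in e′ | S y in e
  ... | true  | true  = s≤s (count-≤ xs S′⊆S)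
  ... | true  | false with () ← trans (sym e) (S′⊆S y e′)
  ... | false | true  = m≤n⇒m≤1+n (count-≤ xs S′⊆S)
  ... | false | false = count-≤ xs S′⊆S

  count-< : ∀ {S′ S x} xs → S′ ⊆ᵥ S → x ∈ xs → S x ≡ true → S′ x ≡ false →
            length (filterᵇ S′ xs) < length (filterᵇ S xs)
  count-< {S′} {S} (y ∷ xs) S′⊆S (here refl) Sx S′x rewrite Sx | S′x = s≤s (count-≤ xs S′⊆S)
  count-< {S′} {S} (y ∷ xs) S′⊆S (there x∈xs) Sx S′x with S′ y in e′ | S y in e
  ... | true  | true  = s≤s (count-< xs S′⊆S x∈xs Sx S′x)
  ... | true  | false with () ← trans (sym e) (S′⊆S y e′)
  ... | false | true  = m≤n⇒m≤1+n (count-< xs S′⊆S x∈xs Sx S′x)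
  ... | false | false = count-< xs S′⊆S x∈xs Sx S′x

  size-pos : ∀ {S x} → S x ≡ true → 0 < size S
  size-pos {S} {x} Sx = filter-some (T? ∘ S) (lose (∈-allFin x) (Equivalence.from T-≡ Sx))

  lost-member : ∀ {S′ S} x → S′ ⊆ᵥ S → S′ x ≢ S x → S′ x ≡ false × S x ≡ true
  lost-member {S′} {S} x S′⊆S S′x≢Sx with S′ x in e′ | S x in e
  ... | true  | true  = ⊥-elim (S′x≢Sx refl)
  ... | true  | false with () ← trans (sym e) (S′⊆S x e′)
  ... | false | true  = refl , refl
  ... | false | false = ⊥-elim (S′x≢Sx refl)

-- Iterating a deflationary operation g on vertex sets of Fin n, starting from
-- the full set, stabilises within n rounds: each non-stable round deletes a vertex.
module Deflation {n : ℕ} (g : VSet n → VSet n)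
                 (shrinks : ∀ S → g S ⊆ᵥ S) (respects : ∀ {S S′} → S ≐ᵥ S′ → g S ≐ᵥ g S′) where

  stage : ℕ → VSet n
  stage k = iter k g (λ _ → true)

  Stable : VSet n → Set
  Stable S = g S ≐ᵥ S

  stage-suc : ∀ k → stage (suc k) ≡ g (stage k)
  stage-suc k = iter-suc k g (λ _ → true)

  stable-suc : ∀ k → Stable (stage k) → Stable (stage (suc k))
  stable-suc k stable = subst Stable (sym (stage-suc k)) (respects stable)

  progress : ∀ k → Stable (stage k) ⊎ size (stage k) + k ≤ n
  progress zero = inj₂ (begin
    size (stage 0) + 0 ≡⟨ +-identityʳ _ ⟩
    size (stage 0)     ≤⟨ length-filter (T? ∘ stage 0) (allFin n) ⟩
    length (allFin n)  ≡⟨ length-tabulate (λ i → i) ⟩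
    n                  ∎)
    where open ≤-Reasoning
  progress (suc k) with progress k
  ... | inj₁ stable = inj₁ (stable-suc k stable)
  ... | inj₂ bound with all? (λ x → g (stage k) x ≟ᵇ stage k x)
  ... | yes stable  = inj₁ (stable-suc k stable)
  ... | no unstable with ¬∀⟶∃¬ n _ (λ x → g (stage k) x ≟ᵇ stage k x) unstable
  ... | x , gx≢x = inj₂ (begin
    size (stage (suc k)) + suc k   ≡⟨ cong (λ S → size S + suc k) (stage-suc k) ⟩
    size (g (stage k)) + suc k     ≡⟨ +-suc _ k ⟩
    suc (size (g (stage k)) + k)   ≤⟨ +-monoˡ-≤ k shrunk ⟩
    size (stage k) + k             ≤⟨ bound ⟩
    n                              ∎)
    where
    open ≤-Reasoning
    shrunk : size (g (stage k)) < size (stage k)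
    shrunk with lost-member x (shrinks (stage k)) gx≢x
    ... | gx≡false , x∈ = count-< (allFin n) (shrinks (stage k)) (∈-allFin x) x∈ gx≡false

  final-kept : ∀ x → stage n x ≡ true → g (stage n) x ≡ true
  final-kept x x∈ with progress n
  ... | inj₁ stable = trans (stable x) x∈
  ... | inj₂ bound  = ⊥-elim (<-irrefl refl (≤-trans (+-monoˡ-≤ n (size-pos {S = stage n} x∈)) bound))

MinDegree : ∀ {n} → ℕ → Hypergraph3 n → VSet n → Set
MinDegree k H S = ∀ u → S u ≡ true → k ≤ degIn H S u

core-minDegree : ∀ {n} k (H : Hypergraph3 n) → MinDegree k H (coreVertices k H)
core-minDegree {n} k H u u∈ =
  ≤ᵇ⇒≤ k (degIn H core u) (Equivalence.from T-≡ (proj₂ (∧-true (final-kept u u∈))))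
  where
  core = coreVertices k H
  degIn-cong : ∀ {S S′} → S ≐ᵥ S′ → ∀ x → degIn H S x ≡ degIn H S′ x
  degIn-cong S≐S′ x = cong length (filterᵇ-cong
    (λ z → cong₂ _∧_ (S≐S′ (proj₁ z)) (cong₂ _∧_ (S≐S′ (proj₂ z)) refl)) (orderedPairs n))
  open Deflation (deleteRound k H) (λ S x e → proj₁ (∧-true e))
                 (λ S≐S′ x → cong₂ _∧_ (S≐S′ x) (cong (k ≤ᵇ_) (degIn-cong S≐S′ x)))

-- Distinctness of a vector of positions, decided by evaluation when the positions are concrete.
distinct? : ∀ {m k} (σ : Vec (Fin m) k) → Dec (Distinct σ)
distinct? = allPairs? (λ i j → ¬? (i ≟ j))

module _ {A : Set} where

  pick : ∀ {m k} → Vec A m → Vec (Fin m) k → Vec A k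
  pick U σ = Vec.map (lookup U) σ

  pick-distinct : ∀ {m k} {U : Vec A m} → Distinct U → (σ : Vec (Fin m) k) → {True (distinct? σ)} →
                  Distinct (pick U σ)
  pick-distinct uU σ {σ-distinct} = map⁺ (λ {i} {j} → lookup-injective uU i j) (toWitness σ-distinct)

distinct-fromList : ∀ {A : Set} {xs : List A} → Unique xs → Distinct (Vec.fromList xs)
distinct-fromList []            = []
distinct-fromList (x∉xs ∷ uxs) = fromList⁺ x∉xs ∷ distinct-fromList uxs

module LoosePaths {n : ℕ} (H : Hypergraph3 n) where

  open import Data.List.Membership.DecPropositional (_≟_ {n}) using (_∈?_)

  E : Fin n → Fin n → Fin n → Set
  E x y z = edge H x y z ≡ true

  swap₁₂ : ∀ {x y z} → E x y z → E y x z
  swap₁₂ {x} {y} {z} e = trans (sym (sym₁₂ H x y z)) e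

  swap₂₃ : ∀ {x y z} → E x y z → E x z y
  swap₂₃ {x} {y} {z} e = trans (sym (sym₂₃ H x y z)) e

  reverse : ∀ {x y z} → E x y z → E z y x
  reverse e = swap₁₂ (swap₂₃ (swap₁₂ e))

  loosePath : ∀ {m} {U : Vec (Fin n) m} → Distinct U → (σ : Vec (Fin m) 7) → {True (distinct? σ)} →
              let x = lookup (pick U σ) in
              E (x (# 0)) (x (# 1)) (x (# 2)) → E (x (# 2)) (x (# 3)) (x (# 4)) →
              E (x (# 4)) (x (# 5)) (x (# 6)) → ContainsLoosePath H
  loosePath {U = U} uU σ {σ-distinct} e₁ e₂ e₃ =
    pick U σ , (λ {i} {j} → lookup-injective (pick-distinct uU σ {σ-distinct}) i j) , e₁ , e₂ , e₃

  module Escape {v r a b c d p q : Fin n} {T : List (Fin n)}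
    (distinct₆ : Distinct (v ∷ r ∷ a ∷ b ∷ c ∷ d ∷ []))
    (vab : E v a b) (vcd : E v c d) (vra : E v r a)
    (a∈T : a ∈ T) (b∈T : b ∈ T) (c∈T : c ∈ T) (d∈T : d ∈ T)
    (rpq : E r p q) (p≢v : p ≢ v) (q≢v : q ≢ v) (q∉T : q ∉ T) where

    ∉T : ∀ {x y} → y ∉ T → x ∈ T → y ≢ x
    ∉T y∉T x∈T y≡x = y∉T (subst (_∈ T) (sym y≡x) x∈T)

    r≢p : r ≢ p
    r≢p = let (r≢p , _ , _) = distinct H r p q rpq in r≢p
    p≢q : p ≢ q
    p≢q = let (_ , p≢q , _) = distinct H r p q rpq in p≢q
    r≢q : r ≢ q
    r≢q = let (_ , _ , r≢q) = distinct H r p q rpq in r≢q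

    U₇ : Vec (Fin n) 7
    U₇ = q ∷ v ∷ r ∷ a ∷ b ∷ c ∷ d ∷ []

    distinct₇ : Distinct U₇
    distinct₇ = (q≢v ∷ ≢-sym r≢q ∷ ∉T q∉T a∈T ∷ ∉T q∉T b∈T ∷ ∉T q∉T c∈T ∷ ∉T q∉T d∈T ∷ []) ∷ distinct₆

    distinct₈ : p ≢ a → p ≢ b → p ≢ c → p ≢ d → Distinct (p ∷ U₇)
    distinct₈ p≢a p≢b p≢c p≢d = (p≢q ∷ p≢v ∷ ≢-sym r≢p ∷ p≢a ∷ p≢b ∷ p≢c ∷ p≢d ∷ []) ∷ distinct₇

    r-to : ∀ {x} → p ≡ x → E r x q
    r-to p≡x = subst (λ x → E r x q) p≡x rpq

    loose : ContainsLoosePath H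
    loose with p ≟ a | p ≟ b | p ≟ c | p ≟ d
    -- d c v | v b a | a r q
    ... | yes p≡a | _ | _ | _ =
      loosePath distinct₇ (# 6 ∷ # 5 ∷ # 1 ∷ # 4 ∷ # 3 ∷ # 2 ∷ # 0 ∷ [])
                (reverse vcd) (swap₂₃ vab) (swap₁₂ (r-to p≡a))
    -- d c v | v a r | r b q
    ... | no _ | yes p≡b | _ | _ =
      loosePath distinct₇ (# 6 ∷ # 5 ∷ # 1 ∷ # 3 ∷ # 2 ∷ # 4 ∷ # 0 ∷ [])
                (reverse vcd) (swap₂₃ vra) (r-to p≡b)
    -- b a v | v d c | c r q
    ... | no _ | no _ | yes p≡c | _ =
      loosePath distinct₇ (# 4 ∷ # 3 ∷ # 1 ∷ # 6 ∷ # 5 ∷ # 2 ∷ # 0 ∷ [])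
                (reverse vab) (swap₂₃ vcd) (swap₁₂ (r-to p≡c))
    -- b a v | v c d | d r q
    ... | no _ | no _ | no _ | yes p≡d =
      loosePath distinct₇ (# 4 ∷ # 3 ∷ # 1 ∷ # 5 ∷ # 6 ∷ # 2 ∷ # 0 ∷ [])
                (reverse vab) vcd (swap₁₂ (r-to p≡d))
    -- d c v | v a r | r p q
    ... | no p≢a | no p≢b | no p≢c | no p≢d =
      loosePath (distinct₈ p≢a p≢b p≢c p≢d) (# 7 ∷ # 6 ∷ # 2 ∷ # 4 ∷ # 3 ∷ # 0 ∷ # 1 ∷ [])
                (reverse vcd) (swap₂₃ vra) rpq

  closure : ¬ ContainsLoosePath H →
            ∀ {v r a b c d p q : Fin n} {T : List (Fin n)} →
            Distinct (v ∷ r ∷ a ∷ b ∷ c ∷ d ∷ []) → E v a b → E v c d → E v r a →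
            a ∈ T → b ∈ T → c ∈ T → d ∈ T →
            E r p q → p ≢ v → q ≢ v → q ∈ T
  closure noL {q = q} {T} distinct₆ vab vcd vra a∈T b∈T c∈T d∈T rpq p≢v q≢v with q ∈? T
  ... | yes q∈T = q∈T
  ... | no q∉T  = ⊥-elim (noL (Escape.loose distinct₆ vab vcd vra a∈T b∈T c∈T d∈T rpq p≢v q≢v q∉T))

module Blocking {n : ℕ} (H : Hypergraph3 n) (S : VSet n) where

  open Links H S
  open LoosePaths H using (E; swap₁₂; swap₂₃)
  open import Data.List.Membership.DecPropositional (_≟_ {n}) using (_∈?_)

  Meets : Fin n → List (Fin n) → Set
  Meets v T = ∀ {p q} → S p ≡ true → S q ≡ true → E v p q → p ∈ T ⊎ q ∈ T

  Confined : Fin n → List (Fin n) → Set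
  Confined v T = ∀ {r t} → r ∉ T → t ∈ T → E v r t → ∀ {p q} → E r p q → p ≢ v → q ≢ v → q ∈ T

  Inside : List (Fin n) → Fin n × Fin n → Set
  Inside T z = proj₁ z ∈ T × proj₂ z ∈ T

  inside? : ∀ T z → Dec (Inside T z)
  inside? T z = (proj₁ z ∈? T) ×-dec (proj₂ z ∈? T)

  other-in : ∀ {T : List (Fin n)} {x y} → x ∉ T → x ∈ T ⊎ y ∈ T → y ∈ T
  other-in x∉T = [ ⊥-elim ∘ x∉T , id ]′

  degree-inside : ∀ x T → All (Inside T) (link x) → degIn H S x ≤ length (pairsOf T)
  degree-inside x T inside = degree-≤ x (pairsOf T) covered
    where
    covered : link x ⊆ pairsOf T
    covered {p , q} m with All.lookup inside m | ∈-link m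
    ... | p∈T , q∈T | _ , p<q = ∈-pairsOf T p∈T q∈T p<q

  -- A neighbour r ∉ T of v, attached to T by an edge {v,r,t}, has degree at most
  -- |T| + C(|T|,2): its link pairs through v are spokes {v,q} with q ∈ T (as T meets
  -- the link edge {r,q} of v), and its other link pairs lie inside T by confinement.
  degree-attached : ∀ {v T r t} → Meets v T → Confined v T → S r ≡ true → r ∉ T → t ∈ T → E v r t →
                    degIn H S r ≤ length T + length (pairsOf T)
  degree-attached {v} {T} {r} meets confined Sr r∉T t∈T vrt =
    ≤-trans (degree-≤ r (spokes v T ++ pairsOf T) covered) (≤-reflexive (length-spokes-pairsOf v T))
    where
    via-v : ∀ {q} → S q ≡ true → E r v q → q ∈ T
    via-v Sq rvq = other-in r∉T (meets Sr Sq (swap₁₂ rvq))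
    covered : link r ⊆ spokes v T ++ pairsOf T
    covered {p , q} m with ∈-link m
    ... | (Sp , Sq , rpq) , p<q with p ≟ v | q ≟ v
    ... | yes refl | _        = ∈-++⁺ˡ (∈-spokesˡ T (via-v Sq rpq) p<q)
    ... | no _     | yes refl = ∈-++⁺ˡ (∈-spokesʳ T (via-v Sp (swap₂₃ rpq)) p<q)
    ... | no p≢v   | no q≢v   = ∈-++⁺ʳ (spokes v T)
      (∈-pairsOf T (confined r∉T t∈T vrt (swap₂₃ rpq) q≢v p≢v) (confined r∉T t∈T vrt rpq p≢v q≢v) p<q)

  below-minimum : ∀ {k u b} → MinDegree k H S → S u ≡ true → degIn H S u ≤ b → b < k → ⊥
  below-minimum minDeg Su deg≤b b<k = <-irrefl refl (≤-<-trans (≤-trans (minDeg _ Su) deg≤b) b<k)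

  -- Either all link pairs of v lie in T, and v has degree at
  -- most C(|T|,2); or some link edge {r,t} of v has r ∉ T, t ∈ T, and r has degree at
  -- most |T| + C(|T|,2).  Both contradict the minimum degree.
  blocked : ∀ {k v T} → MinDegree k H S → S v ≡ true → Meets v T → Confined v T →
            length T + length (pairsOf T) < k → ⊥
  blocked {k} {v} {T} minDeg Sv meets confined small
    with All.all? (inside? T) (link v)
  ... | yes inside =
    below-minimum minDeg Sv (≤-trans (degree-inside v T inside) (m≤n+m _ (length T))) small
  ... | no outside with find (¬All⇒Any¬ (inside? T) (link v) outside)
  ... | (p , q) , m , ¬inside with ∈-link m
  ... | (Sp , Sq , vpq) , _ with p ∈? T | q ∈? T
  ... | yes p∈T | yes q∈T = ¬inside (p∈T , q∈T)
  ... | yes p∈T | no q∉T  =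
    below-minimum minDeg Sq (degree-attached meets confined Sq q∉T p∈T (swap₂₃ vpq)) small
  ... | no p∉T  | _       =
    below-minimum minDeg Sp (degree-attached meets confined Sp p∉T (other-in p∉T (meets Sp Sq vpq)) vpq) small

module _ {n : ℕ} (G : Fin n → Fin n → Bool) where

  open import Data.List.Membership.DecPropositional (_≟_ {n}) using (_∈?_)

  matched : ∀ {m} → HasMatching G m → List (Fin n)
  matched (M , _) = pairVerts M

  extend : ∀ {m p q} (μ : HasMatching G m) → G p q ≡ true → p ≢ q → p ∉ matched μ → q ∉ matched μ →
           HasMatching G (suc m)
  extend (M , length≡m , edges , unique) gpq p≢q p∉ q∉ =
    (_ , _) ∷ M , cong suc length≡m , gpq ∷ edges , (p≢q ∷ ¬Any⇒All¬ _ p∉) ∷ ¬Any⇒All¬ _ q∉ ∷ unique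

  maximum-meets : ∀ {m} (μ : HasMatching G m) → ¬ HasMatching G (suc m) →
                  ∀ {p q} → G p q ≡ true → p ≢ q → p ∈ matched μ ⊎ q ∈ matched μ
  maximum-meets μ maximum {p} {q} gpq p≢q with p ∈? matched μ | q ∈? matched μ
  ... | yes p∈ | _      = inj₁ p∈
  ... | no _   | yes q∈ = inj₂ q∈
  ... | no p∉  | no q∉  = ⊥-elim (maximum (extend μ gpq p≢q p∉ q∉))

module LinkMatchings {n : ℕ} (H : Hypergraph3 n) (S : VSet n) where

  open LoosePaths H
  open Blocking H S

  trace-edge : ∀ {v p q} → S v ≡ true → S p ≡ true → S q ≡ true → E v p q → traceEdge H S v p q ≡ true
  trace-edge Sv Sp Sq vpq rewrite Sv | Sp | Sq = vpq

  trace-edge⁻ : ∀ {v p q} → traceEdge H S v p q ≡ true → E v p q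
  trace-edge⁻ {v} {p} {q} t = proj₂ (∧-true {S q} (proj₂ (∧-true {S p} (proj₂ (∧-true {S v} t)))))

  center-unmatched : ∀ {v m} (μ : HasMatching (traceEdge H S v) m) → v ∉ matched _ μ
  center-unmatched (M , _ , edges , _) = go M edges
    where
    go : ∀ {v} M → All (λ z → traceEdge H S v (proj₁ z) (proj₂ z) ≡ true) M → v ∉ pairVerts M
    go ((p , q) ∷ M) (vpq ∷ _) (here v≡p)         = proj₁ (distinct H _ p q (trace-edge⁻ vpq)) v≡p
    go ((p , q) ∷ M) (vpq ∷ _) (there (here v≡q)) = proj₂ (proj₂ (distinct H _ p q (trace-edge⁻ vpq))) v≡q
    go (_ ∷ M)       (_ ∷ edges) (there (there v∈)) = go M edges v∈

  around : ∀ {v r t} {T : List (Fin n)} → Unique T → v ∉ T → r ∉ T → E v r t →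
           Distinct (Vec.fromList (v ∷ r ∷ T))
  around uT v∉T r∉T vrt = distinct-fromList ((proj₁ (distinct H _ _ _ vrt) ∷ ¬Any⇒All¬ _ v∉T) ∷ ¬Any⇒All¬ _ r∉T ∷ uT)

  no-confining-maximum : ∀ {k v m} → MinDegree k H S → S v ≡ true →
    (μ : HasMatching (traceEdge H S v) m) → ¬ HasMatching (traceEdge H S v) (suc m) →
    Confined v (matched _ μ) → length (matched _ μ) + length (pairsOf (matched _ μ)) < k → ⊥
  no-confining-maximum minDeg Sv μ maximum confined small = blocked minDeg Sv meets confined small
    where
    meets : Meets _ (matched _ μ)
    meets Sp Sq vpq = maximum-meets _ μ maximum (trace-edge Sv Sp Sq vpq) (proj₁ (proj₂ (distinct H _ _ _ vpq)))

-- In an L-free hypergraph, a maximum link matching of size 2 or 3 is confining: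
-- the closure lemma applies with {a,b} the matching edge through t and {c,d} another one.
module LFree {n : ℕ} (H : Hypergraph3 n) (noL : ¬ ContainsLoosePath H) (S : VSet n) where

  open LoosePaths H
  open Blocking H S
  open LinkMatchings H S

  module Matching₂ {v a b c d : Fin n} (uT : Unique (a ∷ b ∷ c ∷ d ∷ []))
    (v∉T : v ∉ a ∷ b ∷ c ∷ d ∷ []) (vab : E v a b) (vcd : E v c d) where

    T₄ : List (Fin n)
    T₄ = a ∷ b ∷ c ∷ d ∷ []

    a∈ : a ∈ T₄
    a∈ = here refl
    b∈ : b ∈ T₄
    b∈ = there (here refl)
    c∈ : c ∈ T₄
    c∈ = there (there (here refl))
    d∈ : d ∈ T₄
    d∈ = there (there (there (here refl)))

    confined : Confined v T₄
    confined r∉T (here refl) vrt = closure noL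
      (pick-distinct (around uT v∉T r∉T vrt) (# 0 ∷ # 1 ∷ # 2 ∷ # 3 ∷ # 4 ∷ # 5 ∷ []))
      vab vcd vrt a∈ b∈ c∈ d∈
    confined r∉T (there (here refl)) vrt = closure noL
      (pick-distinct (around uT v∉T r∉T vrt) (# 0 ∷ # 1 ∷ # 3 ∷ # 2 ∷ # 4 ∷ # 5 ∷ []))
      (swap₂₃ vab) vcd vrt b∈ a∈ c∈ d∈
    confined r∉T (there (there (here refl))) vrt = closure noL
      (pick-distinct (around uT v∉T r∉T vrt) (# 0 ∷ # 1 ∷ # 4 ∷ # 5 ∷ # 2 ∷ # 3 ∷ []))
      vcd vab vrt c∈ d∈ a∈ b∈
    confined r∉T (there (there (there (here refl)))) vrt = closure noL
      (pick-distinct (around uT v∉T r∉T vrt) (# 0 ∷ # 1 ∷ # 5 ∷ # 4 ∷ # 2 ∷ # 3 ∷ []))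
      (swap₂₃ vcd) vab vrt d∈ c∈ a∈ b∈

  module Matching₃ {v a b c d e f : Fin n} (uT : Unique (a ∷ b ∷ c ∷ d ∷ e ∷ f ∷ []))
    (v∉T : v ∉ a ∷ b ∷ c ∷ d ∷ e ∷ f ∷ []) (vab : E v a b) (vcd : E v c d) (vef : E v e f) where

    T₆ : List (Fin n)
    T₆ = a ∷ b ∷ c ∷ d ∷ e ∷ f ∷ []

    a∈ : a ∈ T₆
    a∈ = here refl
    b∈ : b ∈ T₆
    b∈ = there (here refl)
    c∈ : c ∈ T₆
    c∈ = there (there (here refl))
    d∈ : d ∈ T₆
    d∈ = there (there (there (here refl)))
    e∈ : e ∈ T₆
    e∈ = there (there (there (there (here refl))))
    f∈ : f ∈ T₆
    f∈ = there (there (there (there (there (here refl)))))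

    confined : Confined v T₆
    confined r∉T (here refl) vrt = closure noL
      (pick-distinct (around uT v∉T r∉T vrt) (# 0 ∷ # 1 ∷ # 2 ∷ # 3 ∷ # 4 ∷ # 5 ∷ []))
      vab vcd vrt a∈ b∈ c∈ d∈
    confined r∉T (there (here refl)) vrt = closure noL
      (pick-distinct (around uT v∉T r∉T vrt) (# 0 ∷ # 1 ∷ # 3 ∷ # 2 ∷ # 4 ∷ # 5 ∷ []))
      (swap₂₃ vab) vcd vrt b∈ a∈ c∈ d∈
    confined r∉T (there (there (here refl))) vrt = closure noL
      (pick-distinct (around uT v∉T r∉T vrt) (# 0 ∷ # 1 ∷ # 4 ∷ # 5 ∷ # 2 ∷ # 3 ∷ []))
      vcd vab vrt c∈ d∈ a∈ b∈
    confined r∉T (there (there (there (here refl)))) vrt = closure noL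
      (pick-distinct (around uT v∉T r∉T vrt) (# 0 ∷ # 1 ∷ # 5 ∷ # 4 ∷ # 2 ∷ # 3 ∷ []))
      (swap₂₃ vcd) vab vrt d∈ c∈ a∈ b∈
    confined r∉T (there (there (there (there (here refl))))) vrt = closure noL
      (pick-distinct (around uT v∉T r∉T vrt) (# 0 ∷ # 1 ∷ # 6 ∷ # 7 ∷ # 2 ∷ # 3 ∷ []))
      vef vab vrt e∈ f∈ a∈ b∈
    confined r∉T (there (there (there (there (there (here refl)))))) vrt = closure noL
      (pick-distinct (around uT v∉T r∉T vrt) (# 0 ∷ # 1 ∷ # 7 ∷ # 6 ∷ # 2 ∷ # 3 ∷ []))
      (swap₂₃ vef) vab vrt f∈ e∈ a∈ b∈

  -- For minimum degree k > 4 + C(4,2) = 10, no link of a vertex of S has matching number 2.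
  ν≢2 : ∀ {k v} → MinDegree k H S → S v ≡ true → 10 < k → ¬ MatchingNumberIs (traceEdge H S v) 2
  ν≢2 minDeg Sv small (μ@(((a , b) ∷ (c , d) ∷ []) , refl , vab ∷ vcd ∷ [] , uT) , maximum) =
    no-confining-maximum minDeg Sv μ maximum
      (Matching₂.confined uT (center-unmatched μ) (trace-edge⁻ vab) (trace-edge⁻ vcd)) small

  -- For minimum degree k > 6 + C(6,2) = 21, no link of a vertex of S has matching number 3.
  ν≢3 : ∀ {k v} → MinDegree k H S → S v ≡ true → 21 < k → ¬ MatchingNumberIs (traceEdge H S v) 3
  ν≢3 minDeg Sv small (μ@(((a , b) ∷ (c , d) ∷ (e , f) ∷ []) , refl , vab ∷ vcd ∷ vef ∷ [] , uT) , maximum) =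
    no-confining-maximum minDeg Sv μ maximum
      (Matching₃.confined uT (center-unmatched μ) (trace-edge⁻ vab) (trace-edge⁻ vcd) (trace-edge⁻ vef)) small

mainTheorem7 : ∀ {n : ℕ} (H : Hypergraph3 n) → ¬ ContainsLoosePath H →
    ∀ (v : Fin n) → coreVertices 22 H v ≡ true →
      ¬ MatchingNumberIs (traceEdge H (coreVertices 22 H) v) 2 ×
      ¬ MatchingNumberIs (traceEdge H (coreVertices 22 H) v) 3
mainTheorem7 H noL v v∈core =
  ν≢2 (core-minDegree 22 H) v∈core (from-yes (10 <? 22)) ,
  ν≢3 (core-minDegree 22 H) v∈core (from-yes (21 <? 22))
  where open LFree H noL (coreVertices 22 H)
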